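{- Let $\mathbf x$ be an infinite word over a finite alphabet satisfying $r(i,\mathbf x) \le 2i+1$ for all $i \ge 1$. Let $m,n$ be positive integers with $r(n,\mathbf x) = 2n+1$ and $m \ge 2n+1$. Let $k\ge1$ be the integer such that $m \le r(k,\mathbf x)$ and either $k=1$ or $r(k-1,\mathbf x) < m$. Then $k\ge n$ and $r(k,\mathbf x) - k \le m-n$.
   Context: With $x_i^j = x_i\cdots x_j$, $r(n,\mathbf x) = \min\{ m \ge 1 : x_i^{i+n-1} = x_{m-n+1}^{m} \text{ for some } i \text{ with } 1 \le i \le m-n\}$; $n\mapsto r(n,\mathbf x)$ is strictly increasing. -}

module Defs where

open import Data.Nat using (ℕ; _+_; _∸_; _≤_; _<_)
open import Data.Fin using (Fin)
open import Data.Product using (∃-syntax; _×_)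
open import Relation.Nullary using (¬_)
open import Relation.Binary.PropositionalEquality using (_≡_)

-- An infinite word over the finite alphabet Fin d, with 1-based positions:
-- the letter at position p ≥ 1 is x p (the value x 0 is irrelevant).
Word : ℕ → Set
Word d = ℕ → Fin d

-- Occurs x n m : the suffix x_{m-n+1}^m of length n of the prefix x_1^m
-- equals x_i^{i+n-1} for some i with 1 ≤ i ≤ m - n.
Occurs : ∀ {d} → Word d → ℕ → ℕ → Set
Occurs x n m =
  ∃[ i ] (1 ≤ i × i ≤ m ∸ n × (∀ j → j < n → x (i + j) ≡ x (m ∸ n + 1 + j)))

IsR : ∀ {d} → Word d → ℕ → ℕ → Set
IsR x n m = 1 ≤ m × Occurs x n m × (∀ m′ → 1 ≤ m′ → m′ < m → ¬ Occurs x n m′)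

module Submission where

-- Write r(n) for r(n, x).  Two facts about the function r drive
-- everything:
--   * r is strictly increasing: if the suffix of length n+1 of x_1^m occurs
--     earlier in x_1^m, dropping the last letter shows that the suffix of
--     length n of x_1^{m-1} occurs earlier in x_1^{m-1}, so r(n) < r(n+1);
--   * hence r grows with slope at least one: r(a) + t ≤ r(a + t).
-- For the theorem, n ≤ k holds because k < n would give
-- r(k) < r(n) = 2n+1 ≤ m ≤ r(k).  Next, k + n < m: if k = n this is
-- m ≥ 2n+1, and if n < k then k ≥ 2, r(k-1) < m, and the slope bound gives
-- r(k-1) ≥ r(n) + (k-1-n) = k + n.  Finally the hypothesis r(k) ≤ 2k+1 yields
-- r(k) - k ≤ k + 1 ≤ m - n.

open import Defs
open import Data.Nat using (zero; suc; _+_; _*_; _∸_; _≤_; _<_; _≥_; z≤n; s≤s)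
open import Data.Nat.Properties
open import Data.Nat.Tactic.RingSolver using (solve-∀)
open import Data.Product using (∃-syntax; _×_; _,_)
open import Data.Sum using (_⊎_; inj₁; inj₂)
open import Data.Empty using (⊥-elim)
open import Relation.Binary.PropositionalEquality using (_≡_; refl; sym; trans; subst)

-- r(n, x) is defined for every n ≥ 1 (true e.g. for any word over a finite
-- alphabet, by the pigeonhole principle; here it is a hypothesis).
RDefined : ∀ {d} → Word d → Set
RDefined x = ∀ i → 1 ≤ i → ∃[ ri ] IsR x i ri

occurs-shorten : ∀ {d} (x : Word d) n m → Occurs x (suc n) (suc m) → Occurs x n m
occurs-shorten x n m (i , 1≤i , i≤m∸n , agree) =
  i , 1≤i , i≤m∸n , λ j j<n → agree j (≤-trans j<n (n≤1+n n))

IsR-unique : ∀ {d} (x : Word d) n {a b} → IsR x n a → IsR x n b → a ≡ b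
IsR-unique x n {a} {b} (1≤a , occ-a , least-a) (1≤b , occ-b , least-b) =
  ≤-antisym (≮⇒≥ (λ b<a → least-a b 1≤b b<a occ-b))
            (≮⇒≥ (λ a<b → least-b a 1≤a a<b occ-a))

IsR-step : ∀ {d} (x : Word d) n {a b} → IsR x n a → IsR x (suc n) b → a < b
IsR-step x n {b = zero} _ (() , _)
IsR-step x n {a} {suc b} (_ , _ , least-a) (_ , occ@(i , 1≤i , i≤b∸n , _) , _) =
  s≤s (≮⇒≥ (λ b<a → least-a b 1≤b b<a (occurs-shorten x n b occ)))
  where
  1≤b : 1 ≤ b
  1≤b = ≤-trans 1≤i (≤-trans i≤b∸n (m∸n≤m b n))

IsR-gap : ∀ {d} (x : Word d) → RDefined x
        → ∀ a t {ra rb} → 1 ≤ a → IsR x a ra → IsR x (a + t) rb → ra + t ≤ rb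
IsR-gap x defined a zero {ra} {rb} _ Ra Rb
  rewrite +-identityʳ ra | +-identityʳ a = ≤-reflexive (IsR-unique x a Ra Rb)
IsR-gap x defined a (suc t) {ra} {rb} 1≤a Ra Rb
  with defined (a + t) (≤-trans 1≤a (m≤m+n a t))
... | rc , Rc
  rewrite +-suc ra t | +-suc a t =
  ≤-trans (s≤s (IsR-gap x defined a t 1≤a Ra Rc)) (IsR-step x (a + t) Rc Rb)

IsR-strictMono : ∀ {d} (x : Word d) → RDefined x
               → ∀ {a b ra rb} → 1 ≤ a → a < b → IsR x a ra → IsR x b rb → ra < rb
IsR-strictMono x defined {a} {ra = ra} {rb} 1≤a a<b Ra Rb
  with m≤n⇒∃[o]m+o≡n a<b
... | t , refl =
  ≤-trans (m<m+n ra (s≤s z≤n))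
          (IsR-gap x defined a (suc t) 1≤a Ra (subst (λ c → IsR x c rb) (sym (+-suc a t)) Rb))

-- The shape 2n+1 = (n+1) + n in which the bound r(n) ≤ 2n+1 gets used.
2n+1≡n+1+n : ∀ n → 2 * n + 1 ≡ suc n + n
2n+1≡n+1+n = solve-∀

-- The case k = n is the
-- hypothesis m ≥ 2n+1; n < k = 1 is impossible as n ≥ 1; otherwise
-- k - 1 = n + t and m > r(k-1) ≥ r(n) + t = 2n + 1 + t = k + n.
sum-below-m : ∀ {d} (x : Word d) → RDefined x
            → ∀ m n k → 1 ≤ n → IsR x n (2 * n + 1) → m ≥ 2 * n + 1 → n ≤ k
            → (k ≡ 1 ⊎ ∃[ rk′ ] (IsR x (k ∸ 1) rk′ × rk′ < m))
            → suc k + n ≤ m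
sum-below-m x defined m n k 1≤n Rn m≥ n≤k _ with m≤n⇒m<n∨m≡n n≤k
... | inj₂ refl = subst (_≤ m) (2n+1≡n+1+n n) m≥
sum-below-m x defined m n (suc k₀) 1≤n Rn m≥ n≤k (inj₁ refl) | inj₁ n<k =
  ⊥-elim (<⇒≱ n<k 1≤n)
sum-below-m x defined m n (suc k₀) 1≤n Rn m≥ n≤k (inj₂ (rk′ , Rk′ , rk′<m)) | inj₁ (s≤s n≤k₀)
  with m≤n⇒∃[o]m+o≡n n≤k₀
... | t , refl =
  subst (_≤ m) (shape n t) (≤-trans (s≤s (IsR-gap x defined n t 1≤n Rn Rk′)) rk′<m)
  where
  shape : ∀ n t → suc (2 * n + 1 + t) ≡ suc (suc (n + t)) + n
  shape = solve-∀

lemma5p6 : ∀ d (x : Word d)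
    → (∀ i → 1 ≤ i → ∃[ ri ] (IsR x i ri × ri ≤ 2 * i + 1))
    → ∀ m n → 1 ≤ m → 1 ≤ n
    → IsR x n (2 * n + 1) → m ≥ 2 * n + 1
    → ∀ k rk → 1 ≤ k → IsR x k rk → m ≤ rk
    → (k ≡ 1 ⊎ ∃[ rk′ ] (IsR x (k ∸ 1) rk′ × rk′ < m))
    → n ≤ k × rk ∸ k ≤ m ∸ n
lemma5p6 d x bounded m n _ 1≤n Rn m≥ k rk 1≤k Rk m≤rk previous =
  n≤k , ≤-trans rk∸k≤k+1 (m+n≤o⇒m≤o∸n (suc k) k+n<m)
  where
  defined : RDefined x
  defined i 1≤i = let ri , Ri , _ = bounded i 1≤i in ri , Ri

  n≤k : n ≤ k
  n≤k = ≮⇒≥ (λ k<n → <⇒≱ (IsR-strictMono x defined 1≤k k<n Rk Rn) (≤-trans m≥ m≤rk))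

  k+n<m : suc k + n ≤ m
  k+n<m = sum-below-m x defined m n k 1≤n Rn m≥ n≤k previous

  rk∸k≤k+1 : rk ∸ k ≤ suc k
  rk∸k≤k+1 with bounded k 1≤k
  ... | ri , Ri , ri≤ rewrite IsR-unique x k Ri Rk =
    m≤n+o⇒m∸n≤o rk k (subst (rk ≤_) (trans (2n+1≡n+1+n k) (+-comm (suc k) k)) ri≤)
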